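{- Let $k\ge 3$ and $\ell\ge 1$ be integers. For every integer $n$ with $$n\ \ge\ 2\,\frac{(\ell(k-1)+k)^4-1}{(\ell+1)(k-1)}-1,$$ we have $px_{k,\ell}(K_n)=2$.
   Context: All graphs are finite, simple and undirected; edge-colorings need not be proper. In an edge-colored graph, a tree $T$ is a proper tree if no two adjacent edges of $T$ receive the same color. For a connected graph $G$ and $S\subseteq V(G)$ with $|S|\ge 2$, an $S$-tree is a tree in $G$ containing all vertices of $S$. $S$-trees $T_1,\dots,T_\ell$ are internally disjoint if $E(T_i)\cap E(T_j)=\emptyset$ and $V(T_i)\cap V(T_j)=S$ for all $i\ne j$. For a $k$-subset $S$, $\kappa(S)$ is the maximum number of internally disjoint $S$-trees in $G$, and $\kappa_k(G)=\min\{\kappa(S): S\subseteq V(G),|S|=k\}$. For integers $2\le k\le |V(G)|$ and $1\le \ell\le \kappa_k(G)$, the $(k,\ell)$-proper index $px_{k,\ell}(G)$ is the minimum number of colors in an edge-coloring of $G$ such that for every $k$-subset $S$ of $V(G)$ there exist $\ell$ internally disjoint proper $S$-trees. $K_n$ denotes the complete graph on $n$ vertices. -}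

module Defs where

open import Data.Nat using (ℕ; _≤_; _<_; _+_; _*_; _∸_; _^_)
open import Data.Fin using (Fin)
open import Data.Fin.Subset using (Subset; _∈_; ∣_∣)
open import Data.Bool using (Bool; true)
open import Data.List using (List; []; _∷_; _++_; length)
open import Data.List.Relation.Unary.Linked using (Linked)
open import Data.List.Relation.Unary.Unique.Propositional using (Unique)
open import Data.Product using (Σ; _×_)
open import Relation.Binary.PropositionalEquality using (_≡_; _≢_; ≢-sym; refl)
open import Relation.Nullary using (¬_)

record Graph (N : ℕ) : Set₁ where
  field
    Adj    : Fin N → Fin N → Set
    sym    : ∀ {u v} → Adj u v → Adj v u
    irrefl : ∀ {u} → ¬ Adj u u

K : (N : ℕ) → Graph N
K N = record { Adj = λ u v → u ≢ v ; sym = ≢-sym ; irrefl = λ p → p refl }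

record Subgraph {N : ℕ} (G : Graph N) : Set where
  field
    V     : Subset N
    E     : Fin N → Fin N → Bool
    E-sym : ∀ u v → E u v ≡ E v u
    E-ok  : ∀ u v → E u v ≡ true → Graph.Adj G u v × u ∈ V × v ∈ V

data Walk {N : ℕ} (E : Fin N → Fin N → Bool) : Fin N → Fin N → Set where
  here : ∀ {u} → Walk E u u
  step : ∀ {u v w} → E u v ≡ true → Walk E v w → Walk E u w

Cycle : {N : ℕ} → (Fin N → Fin N → Bool) → Set
Cycle {N} E = Σ (Fin N) λ x → Σ (List (Fin N)) λ ys →
  (2 ≤ length ys) × Unique (x ∷ ys) × Linked (λ a b → E a b ≡ true) (x ∷ ys ++ x ∷ [])

IsTree : {N : ℕ} {G : Graph N} → Subgraph G → Set
IsTree T = (∀ u v → u ∈ V → v ∈ V → Walk E u v) × ¬ Cycle E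
  where open Subgraph T

-- Edge-colorings with m colors (symmetric; values on non-edges irrelevant).
record Coloring (N m : ℕ) : Set where
  field
    col     : Fin N → Fin N → Fin m
    col-sym : ∀ u v → col u v ≡ col v u

IsProper : {N m : ℕ} {G : Graph N} → Coloring N m → Subgraph G → Set
IsProper c T = ∀ u v w → u ≢ w → E u v ≡ true → E v w ≡ true →
  Coloring.col c u v ≢ Coloring.col c v w
  where open Subgraph T

ContainsSet : {N : ℕ} {G : Graph N} → Subset N → Subgraph G → Set
ContainsSet S T = ∀ v → v ∈ S → v ∈ Subgraph.V T

-- Internally disjoint: edge-disjoint and vertex sets intersect exactly in S
-- (⊇ S is already guaranteed by ContainsSet).
InternallyDisjoint : {N : ℕ} {G : Graph N} → Subset N → Subgraph G → Subgraph G → Set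
InternallyDisjoint S T₁ T₂ =
  (∀ u v → ¬ (Subgraph.E T₁ u v ≡ true × Subgraph.E T₂ u v ≡ true)) ×
  (∀ v → v ∈ Subgraph.V T₁ → v ∈ Subgraph.V T₂ → v ∈ S)

GoodColoring : {N m : ℕ} (G : Graph N) (k ℓ : ℕ) → Coloring N m → Set
GoodColoring {N} G k ℓ c = ∀ (S : Subset N) → ∣ S ∣ ≡ k →
  Σ (Fin ℓ → Subgraph G) λ T →
    (∀ i → IsTree (T i) × ContainsSet S (T i) × IsProper c (T i)) ×
    (∀ i j → i ≢ j → InternallyDisjoint S (T i) (T j))

PxIs : {N : ℕ} (G : Graph N) (k ℓ p : ℕ) → Set
PxIs {N} G k ℓ p =
  Σ (Coloring N p) (GoodColoring G k ℓ) ×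
  (∀ q → q < p → ¬ Σ (Coloring N q) (GoodColoring G k ℓ))

-- One color cannot do: then no two edges of a proper tree share an end, so a proper tree has at
-- most two vertices, while k ≥ 3.  Two colors suffice: color an edge by whether the indices of its
-- ends have different parity.  A path whose vertex parities run even, even, odd, odd, … is then
-- proper, and for a k-set S one builds ℓ such paths through S that meet only in S and never join
-- two members of S, using about 4ℓk vertices outside S of each parity; the hypothesis on n
-- provides them.
module Submission where

open import Defs
open import Data.Nat using (ℕ; zero; suc; _≤_; _<_; _+_; _*_; _∸_; _^_; z≤n; s≤s; >-nonZero)
open import Data.Nat.Properties
open import Data.Nat.Tactic.RingSolver using (solve-∀)
open import Data.Nat.DivMod using (_%_; m<n⇒m%n≡m; [m+kn]%n≡m%n)
open import Data.Fin using (Fin; zero; suc; toℕ) renaming (_≟_ to _≟ᶠ_)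
open import Data.Fin.Properties using (toℕ-injective; toℕ<n; ¬Fin0) renaming (suc-injective to fsuc-injective)
open import Data.Fin.Subset using (Subset; _∈_; _∉_; ∣_∣; _∩_; ∁) renaming (⊥ to ∅)
open import Data.Fin.Subset.Properties using (x∈p∩q⁻; x∈∁p⇒x∉p; ∣⊥∣≡0)
open import Data.Bool using (Bool; true; false; not; _xor_; if_then_else_)
open import Data.Bool.Properties using (xor-comm; not-involutive)
open import Data.List using (List; []; _∷_; _++_; length; map)
open import Data.List.Properties using (length-map)
open import Data.List.Membership.Propositional using () renaming (_∈_ to _∈ˡ_)
open import Data.List.Membership.Propositional.Properties using (∈-map⁺; ∈-map⁻)
open import Data.List.Relation.Unary.Any using (here; there)
open import Data.List.Relation.Unary.All.Properties using () renaming (map⁺ to All-map⁺)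
import Data.List.Relation.Unary.Unique.Propositional.Properties as Unique
open import Data.List.Relation.Unary.Linked as Linked using (Linked; [-]; _∷_)
open import Data.List.Relation.Unary.Unique.Propositional using (Unique)
open import Data.List.Relation.Unary.AllPairs using ([]; _∷_)
open import Data.List.Relation.Unary.All as All using (_∷_)
open import Data.Product using (Σ; ∃; _×_; _,_; proj₁; proj₂)
open import Data.Sum using (_⊎_; inj₁; inj₂)
open import Data.Empty using (⊥; ⊥-elim)
open import Data.Vec using ([]; _∷_; tabulate; here; there)
open import Data.Vec.Properties using (lookup∘tabulate; lookup⇒[]=; []=⇒lookup)
open import Function.Base using (_∘_)
open import Function.Bundles using (mk⇔)
open import Relation.Nullary using (¬_; Dec; yes; no; does)
open import Relation.Nullary.Decidable using (dec-true; does-⇔; _×-dec_; _⊎-dec_)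
open import Relation.Binary.PropositionalEquality

does-true⇒ : {A : Set} (a? : Dec A) → does a? ≡ true → A
does-true⇒ (yes a) _ = a
does-true⇒ (no _)  ()

last : {A : Set} → A → List A → A
last x []       = x
last _ (y ∷ ys) = last y ys

Linked-snoc⁻ : {A : Set} {R : A → A → Set} (x : A) (ys : List A) {w : A} →
  Linked R (x ∷ ys ++ w ∷ []) → Linked R (x ∷ ys) × R (last x ys) w
Linked-snoc⁻ x []       (r ∷ _)  = [-] , r
Linked-snoc⁻ x (y ∷ ys) (r ∷ rs) with Linked-snoc⁻ y ys rs
... | rs′ , r′ = r ∷ rs′ , r′

-- Along a cycle without repeated vertices the height is monotone, so the cycle cannot close up.
module HeightGraph {A : Set} (h : A → ℕ) (h-injective : ∀ {a b} → h a ≡ h b → a ≡ b) where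

  Step : A → A → Set
  Step a b = h b ≡ suc (h a) ⊎ h a ≡ suc (h b)

  Ascending : List A → Set
  Ascending = Linked (λ a b → h b ≡ suc (h a))

  Descending : List A → Set
  Descending = Linked (λ a b → h a ≡ suc (h b))

  monotone : ∀ a zs → Linked Step (a ∷ zs) → Unique (a ∷ zs) →
             Ascending (a ∷ zs) ⊎ Descending (a ∷ zs)
  monotone a []           _               _ = inj₁ [-]
  monotone a (b ∷ [])     (inj₁ up ∷ _)   _ = inj₁ (up ∷ [-])
  monotone a (b ∷ [])     (inj₂ dn ∷ _)   _ = inj₂ (dn ∷ [-])
  monotone a (b ∷ c ∷ zs) (s ∷ ss) ((_ ∷ a≢c ∷ _) ∷ u) with monotone b (c ∷ zs) ss u | s
  ... | inj₁ ups        | inj₁ up = inj₁ (up ∷ ups)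
  ... | inj₂ dns        | inj₂ dn = inj₂ (dn ∷ dns)
  ... | inj₁ (up′ ∷ _)  | inj₂ dn = ⊥-elim (a≢c (h-injective (trans dn (sym up′))))
  ... | inj₂ (dn′ ∷ _)  | inj₁ up = ⊥-elim (a≢c (h-injective (suc-injective (trans (sym up) dn′))))

  ascending-last : ∀ a zs → Ascending (a ∷ zs) → h (last a zs) ≡ h a + length zs
  ascending-last a []       _          = sym (+-identityʳ (h a))
  ascending-last a (b ∷ zs) (up ∷ ups) = begin
    h (last b zs)          ≡⟨ ascending-last b zs ups ⟩
    h b + length zs        ≡⟨ cong (_+ length zs) up ⟩
    suc (h a + length zs)  ≡⟨ +-suc (h a) (length zs) ⟨
    h a + suc (length zs)  ∎
    where open ≡-Reasoning

  descending-last : ∀ a zs → Descending (a ∷ zs) → h a ≡ h (last a zs) + length zs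
  descending-last a []       _          = sym (+-identityʳ (h a))
  descending-last a (b ∷ zs) (dn ∷ dns) = begin
    h a                              ≡⟨ dn ⟩
    suc (h b)                        ≡⟨ cong suc (descending-last b zs dns) ⟩
    suc (h (last b zs) + length zs)  ≡⟨ +-suc _ (length zs) ⟨
    h (last b zs) + suc (length zs)  ∎
    where open ≡-Reasoning

  ¬Step-far : ∀ {a b d} → 2 ≤ d → h b ≡ h a + d → ¬ Step a b
  ¬Step-far {a} {d = d} 2≤d hb (inj₁ up) =
    <⇒≢ 2≤d (sym (+-cancelˡ-≡ (h a) d 1 (trans (sym hb) (trans up (sym (+-comm (h a) 1))))))
  ¬Step-far {a} 2≤d hb (inj₂ dn) = m≢1+m+n (h a) (trans dn (cong suc hb))

  Step-sym : ∀ {a b} → Step a b → Step b a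
  Step-sym (inj₁ up) = inj₂ up
  Step-sym (inj₂ dn) = inj₁ dn

  acyclic : ∀ x ys → 2 ≤ length ys → Unique (x ∷ ys) → ¬ Linked Step (x ∷ ys ++ x ∷ [])
  acyclic x ys 2≤len u closed with Linked-snoc⁻ x ys closed
  ... | open-path , closing with monotone x ys open-path u
  ... | inj₁ up = ¬Step-far 2≤len (ascending-last x ys up) (Step-sym closing)
  ... | inj₂ dn = ¬Step-far 2≤len (descending-last x ys dn) closing

module PathGraph {n : ℕ} (f : ℕ → Fin n) (L : ℕ)
  (f-injective : ∀ {p q} → p < L → q < L → f p ≡ f q → p ≡ q) where

  OnPath : Fin n → Set
  OnPath u = ∃ λ p → p < L × f p ≡ u

  Joins : Fin n → Fin n → ℕ → Set
  Joins u v p = suc p < L × (f p ≡ u × f (suc p) ≡ v ⊎ f p ≡ v × f (suc p) ≡ u)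

  PathEdge : Fin n → Fin n → Set
  PathEdge u v = ∃ λ p → p < L × Joins u v p

  onPath? : ∀ u → Dec (OnPath u)
  onPath? u = anyUpTo? (λ p → f p ≟ᶠ u) L

  pathEdge? : ∀ u v → Dec (PathEdge u v)
  pathEdge? u v = anyUpTo? (λ p → (suc p <? L) ×-dec
    (((f p ≟ᶠ u) ×-dec (f (suc p) ≟ᶠ v)) ⊎-dec ((f p ≟ᶠ v) ×-dec (f (suc p) ≟ᶠ u)))) L

  PathEdge-sym : ∀ {u v} → PathEdge u v → PathEdge v u
  PathEdge-sym (p , p<L , sp<L , inj₁ ends) = p , p<L , sp<L , inj₂ ends
  PathEdge-sym (p , p<L , sp<L , inj₂ ends) = p , p<L , sp<L , inj₁ ends

  vertices : Subset n
  vertices = tabulate (λ u → does (onPath? u))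

  edges : Fin n → Fin n → Bool
  edges u v = does (pathEdge? u v)

  ∈-vertices⁺ : ∀ {u} → OnPath u → u ∈ vertices
  ∈-vertices⁺ {u} on = lookup⇒[]= u vertices (trans (lookup∘tabulate _ u) (dec-true (onPath? u) on))

  ∈-vertices⁻ : ∀ {u} → u ∈ vertices → OnPath u
  ∈-vertices⁻ {u} u∈ = does-true⇒ (onPath? u) (trans (sym (lookup∘tabulate _ u)) ([]=⇒lookup u∈))

  edges⁻ : ∀ {u v} → edges u v ≡ true → PathEdge u v
  edges⁻ {u} {v} = does-true⇒ (pathEdge? u v)

  edges⁺ : ∀ {u v} → PathEdge u v → edges u v ≡ true
  edges⁺ {u} {v} = dec-true (pathEdge? u v)

  edges-ok : ∀ u v → edges u v ≡ true → u ≢ v × u ∈ vertices × v ∈ vertices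
  edges-ok u v e with edges⁻ e
  ... | p , p<L , sp<L , inj₁ (refl , refl) =
    (λ eq → <⇒≢ (n<1+n p) (f-injective p<L sp<L eq)) , ∈-vertices⁺ (p , p<L , refl) , ∈-vertices⁺ (suc p , sp<L , refl)
  ... | p , p<L , sp<L , inj₂ (refl , refl) =
    (λ eq → <⇒≢ (n<1+n p) (f-injective p<L sp<L (sym eq))) , ∈-vertices⁺ (suc p , sp<L , refl) , ∈-vertices⁺ (p , p<L , refl)

  path : Subgraph (K n)
  path = record
    { V = vertices ; E = edges
    ; E-sym = λ u v → does-⇔ (mk⇔ PathEdge-sym PathEdge-sym) (pathEdge? u v) (pathEdge? v u)
    ; E-ok = edges-ok }

  forward : ∀ p → suc p < L → edges (f p) (f (suc p)) ≡ true
  forward p sp<L = edges⁺ (p , <-trans (n<1+n p) sp<L , sp<L , inj₁ (refl , refl))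

  backward : ∀ p → suc p < L → edges (f (suc p)) (f p) ≡ true
  backward p sp<L = edges⁺ (p , <-trans (n<1+n p) sp<L , sp<L , inj₂ (refl , refl))

  walk-forward : ∀ p d → p + d < L → Walk edges (f p) (f (p + d))
  walk-forward p zero    _ rewrite +-identityʳ p = here
  walk-forward p (suc d) lt rewrite +-suc p d =
    step (forward p (≤-<-trans (s≤s (m≤m+n p d)) lt)) (walk-forward (suc p) d lt)

  walk-backward : ∀ p d → p + d < L → Walk edges (f (p + d)) (f p)
  walk-backward p zero    _ rewrite +-identityʳ p = here
  walk-backward p (suc d) lt rewrite +-suc p d =
    step (backward (p + d) lt) (walk-backward p d (<-trans (n<1+n _) lt))

  walk : ∀ p q → p < L → q < L → Walk edges (f p) (f q)
  walk p q _ q<L with p ≤? q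
  ... | yes p≤q = subst (λ r → Walk edges (f p) (f r)) (m+[n∸m]≡n p≤q)
                    (walk-forward p (q ∸ p) (subst (_< L) (sym (m+[n∸m]≡n p≤q)) q<L))
  walk p q p<L _ | no p≰q = subst (λ r → Walk edges (f r) (f q)) (m+[n∸m]≡n q≤p)
                    (walk-backward q (p ∸ q) (subst (_< L) (sym (m+[n∸m]≡n q≤p)) p<L))
    where q≤p = ≰⇒≥ p≰q

  connected : ∀ u v → u ∈ vertices → v ∈ vertices → Walk edges u v
  connected u v u∈ v∈ with ∈-vertices⁻ u∈ | ∈-vertices⁻ v∈
  ... | p , p<L , refl | q , q<L , refl = walk p q p<L q<L

  -- Vertices off the path are given heights beyond L, so that the height is injective.
  height : Fin n → ℕ
  height u with onPath? u
  ... | yes (p , _) = p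
  ... | no _        = L + toℕ u

  height-f : ∀ {p} → p < L → height (f p) ≡ p
  height-f {p} p<L with onPath? (f p)
  ... | yes (q , q<L , fq≡fp) = f-injective q<L p<L fq≡fp
  ... | no off = ⊥-elim (off (p , p<L , refl))

  height-injective : ∀ {a b} → height a ≡ height b → a ≡ b
  height-injective {a} {b} eq with onPath? a | onPath? b
  ... | yes (p , _ , refl) | yes (q , _ , refl) = cong f eq
  ... | yes (p , p<L , _)  | no _ = ⊥-elim (<⇒≢ (<-≤-trans p<L (m≤m+n L _)) eq)
  ... | no _ | yes (q , q<L , _)  = ⊥-elim (<⇒≢ (<-≤-trans q<L (m≤m+n L _)) (sym eq))
  ... | no _ | no _               = toℕ-injective (+-cancelˡ-≡ L _ _ eq)

  open HeightGraph height height-injective using (Step; acyclic)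

  edge⇒Step : ∀ {a b} → edges a b ≡ true → Step a b
  edge⇒Step e with edges⁻ e
  ... | p , p<L , sp<L , inj₁ (refl , refl) = inj₁ (trans (height-f sp<L) (cong suc (sym (height-f p<L))))
  ... | p , p<L , sp<L , inj₂ (refl , refl) = inj₂ (trans (height-f sp<L) (cong suc (sym (height-f p<L))))

  path-isTree : IsTree path
  path-isTree = connected , λ (x , ys , 2≤len , u , closed) → acyclic x ys 2≤len u (Linked.map edge⇒Step closed)

  Consecutive : Fin n → Fin n → Fin n → ℕ → Set
  Consecutive u v w p = u ≡ f p × v ≡ f (suc p) × w ≡ f (suc (suc p))

  adjacent-edges : ∀ {u v w} → u ≢ w → edges u v ≡ true → edges v w ≡ true →
    ∃ λ p → suc (suc p) < L × (Consecutive u v w p ⊎ Consecutive w v u p)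
  adjacent-edges u≢w e₁ e₂ with edges⁻ e₁ | edges⁻ e₂
  ... | p , p<L , sp<L , inj₁ (refl , refl) | q , q<L , sq<L , inj₁ (eq , refl)
    with f-injective q<L sp<L eq
  ... | refl = p , sq<L , inj₁ (refl , refl , refl)
  adjacent-edges u≢w e₁ e₂ | p , p<L , sp<L , inj₁ (refl , refl) | q , q<L , sq<L , inj₂ (refl , eq)
    with f-injective p<L q<L (cong f (suc-injective (f-injective sp<L sq<L (sym eq))))
  ... | refl = ⊥-elim (u≢w refl)
  adjacent-edges u≢w e₁ e₂ | p , p<L , sp<L , inj₂ (refl , refl) | q , q<L , sq<L , inj₁ (eq , refl)
    with f-injective p<L q<L (sym eq)
  ... | refl = ⊥-elim (u≢w refl)
  adjacent-edges u≢w e₁ e₂ | p , p<L , sp<L , inj₂ (refl , refl) | q , q<L , sq<L , inj₂ (refl , eq)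
    with f-injective sq<L p<L eq
  ... | refl = q , sp<L , inj₂ (refl , refl , refl)

  path-isProper : ∀ {m} (c : Coloring n m) → let open Coloring c in
    (∀ p → suc (suc p) < L → col (f p) (f (suc p)) ≢ col (f (suc p)) (f (suc (suc p)))) →
    IsProper c path
  path-isProper c alternating u v w u≢w e₁ e₂ with adjacent-edges u≢w e₁ e₂
  ... | p , ssp<L , inj₁ (refl , refl , refl) = alternating p ssp<L
  ... | p , ssp<L , inj₂ (refl , refl , refl) = λ eq →
    alternating p ssp<L (trans (col-sym _ _) (trans (sym eq) (col-sym _ _)))
    where open Coloring c

parity : {n : ℕ} → Fin n → Bool
parity zero    = true
parity (suc i) = not (parity i)

fromBool : Bool → Fin 2
fromBool true  = suc zero
fromBool false = zero

fromBool-injective : ∀ {a b} → fromBool a ≡ fromBool b → a ≡ b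
fromBool-injective {true}  {true}  _ = refl
fromBool-injective {false} {false} _ = refl

parityColoring : (n : ℕ) → Coloring n 2
parityColoring n = record
  { col = λ u v → fromBool (parity u xor parity v)
  ; col-sym = λ u v → cong fromBool (xor-comm (parity u) (parity v)) }

xor-cancel-middle : ∀ a b c → a xor b ≡ b xor c → a ≡ c
xor-cancel-middle true  true  true  _ = refl
xor-cancel-middle true  false true  _ = refl
xor-cancel-middle false true  false _ = refl
xor-cancel-middle false false false _ = refl
xor-cancel-middle true  true  false ()
xor-cancel-middle true  false false ()
xor-cancel-middle false true  true  ()
xor-cancel-middle false false true  ()

parityColoring-alternates : ∀ {n} (a b c : Fin n) → parity a ≢ parity c →
  let open Coloring (parityColoring n) in col a b ≢ col b c
parityColoring-alternates a b c a≢c eq = a≢c (xor-cancel-middle _ _ _ (fromBool-injective eq))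

parityClass : {n : ℕ} → Bool → Subset n
parityClass {zero}  b = []
parityClass {suc n} b = b ∷ parityClass (not b)

parityClass-parity : ∀ {n b} {x : Fin n} → x ∈ parityClass b → parity x ≡ b
parityClass-parity {x = zero}          here     = refl
parityClass-parity {b = b} {x = suc x} (there x∈) =
  trans (cong not (parityClass-parity x∈)) (not-involutive b)

mutual
  evens-size : ∀ n → n ≤ 2 * ∣ parityClass {n} true ∣
  evens-size zero    = z≤n
  evens-size (suc n) = ≤-trans (s≤s (odds-size n)) (≤-reflexive (sym (*-suc 2 ∣ parityClass {n} false ∣)))

  odds-size : ∀ n → n ≤ suc (2 * ∣ parityClass {n} false ∣)
  odds-size zero    = z≤n
  odds-size (suc n) = s≤s (evens-size n)

parityClass-size : ∀ n b → n ≤ suc (2 * ∣ parityClass {n} b ∣)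
parityClass-size n true  = ≤-trans (evens-size n) (n≤1+n _)
parityClass-size n false = odds-size n

∣p∣≤∣p∩∁q∣+∣q∣ : ∀ {n} (p q : Subset n) → ∣ p ∣ ≤ ∣ p ∩ ∁ q ∣ + ∣ q ∣
∣p∣≤∣p∩∁q∣+∣q∣ []          []          = z≤n
∣p∣≤∣p∩∁q∣+∣q∣ (true ∷ p)  (true ∷ q)  =
  ≤-trans (s≤s (∣p∣≤∣p∩∁q∣+∣q∣ p q)) (≤-reflexive (sym (+-suc _ ∣ q ∣)))
∣p∣≤∣p∩∁q∣+∣q∣ (true ∷ p)  (false ∷ q) = s≤s (∣p∣≤∣p∩∁q∣+∣q∣ p q)
∣p∣≤∣p∩∁q∣+∣q∣ (false ∷ p) (true ∷ q)  =
  ≤-trans (∣p∣≤∣p∩∁q∣+∣q∣ p q) (+-monoʳ-≤ ∣ p ∩ ∁ q ∣ (n≤1+n ∣ q ∣))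
∣p∣≤∣p∩∁q∣+∣q∣ (false ∷ p) (false ∷ q) = ∣p∣≤∣p∩∁q∣+∣q∣ p q

members : {n : ℕ} → Subset n → List (Fin n)
members []          = []
members (true ∷ p)  = zero ∷ map suc (members p)
members (false ∷ p) = map suc (members p)

length-members : ∀ {n} (p : Subset n) → length (members p) ≡ ∣ p ∣
length-members []          = refl
length-members (true ∷ p)  = cong suc (trans (length-map suc (members p)) (length-members p))
length-members (false ∷ p) = trans (length-map suc (members p)) (length-members p)

members-unique : ∀ {n} (p : Subset n) → Unique (members p)
members-unique []          = []
members-unique (true ∷ p)  =
  All-map⁺ (All.universal (λ _ ()) (members p)) ∷ Unique.map⁺ fsuc-injective (members-unique p)
members-unique (false ∷ p) = Unique.map⁺ fsuc-injective (members-unique p)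

∈-members⁺ : ∀ {n} {p : Subset n} {x} → x ∈ p → x ∈ˡ members p
∈-members⁺ {p = true ∷ p}  here       = here refl
∈-members⁺ {p = true ∷ p}  (there x∈) = there (∈-map⁺ suc (∈-members⁺ x∈))
∈-members⁺ {p = false ∷ p} (there x∈) = ∈-map⁺ suc (∈-members⁺ x∈)

∈-members⁻ : ∀ {n} {p : Subset n} {x} → x ∈ˡ members p → x ∈ p
∈-members⁻ {p = true ∷ p}  (here refl) = here
∈-members⁻ {p = true ∷ p}  (there x∈)  with ∈-map⁻ suc x∈
... | _ , y∈ , refl = there (∈-members⁻ y∈)
∈-members⁻ {p = false ∷ p} x∈ with ∈-map⁻ suc x∈
... | _ , y∈ , refl = there (∈-members⁻ y∈)

nth : {A : Set} → A → List A → ℕ → A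
nth d []       _       = d
nth d (x ∷ xs) zero    = x
nth d (x ∷ xs) (suc j) = nth d xs j

nth-∈ : {A : Set} {d : A} (xs : List A) {j : ℕ} → j < length xs → nth d xs j ∈ˡ xs
nth-∈ (x ∷ xs) {zero}  _         = here refl
nth-∈ (x ∷ xs) {suc j} (s≤s j<) = there (nth-∈ xs j<)

nth-injective : {A : Set} {d : A} {xs : List A} → Unique xs → ∀ {i j} →
  i < length xs → j < length xs → nth d xs i ≡ nth d xs j → i ≡ j
nth-injective {xs = x ∷ xs} _             {zero}  {zero}  _         _         _  = refl
nth-injective {xs = x ∷ xs} (x∉ ∷ _)      {zero}  {suc j} _         (s≤s j<) eq =
  ⊥-elim (All.lookup x∉ (nth-∈ xs j<) eq)
nth-injective {xs = x ∷ xs} (x∉ ∷ _)      {suc i} {zero}  (s≤s i<) _         eq =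
  ⊥-elim (All.lookup x∉ (nth-∈ xs i<) (sym eq))
nth-injective {xs = x ∷ xs} (_ ∷ unique)  {suc i} {suc j} (s≤s i<) (s≤s j<) eq =
  cong suc (nth-injective unique i< j< eq)

∈⇒nth : {A : Set} {d x : A} {xs : List A} → x ∈ˡ xs → ∃ λ j → j < length xs × nth d xs j ≡ x
∈⇒nth (here refl) = zero , s≤s z≤n , refl
∈⇒nth (there x∈) with ∈⇒nth x∈
... | j , j< , eq = suc j , s≤s j< , eq

pool : {n : ℕ} → Subset n → Bool → List (Fin n)
pool S b = members (parityClass b ∩ ∁ S)

∈-pool : ∀ {n} {S : Subset n} {b x} → x ∈ˡ pool S b → x ∉ S × parity x ≡ b
∈-pool {S = S} {b} x∈ with x∈p∩q⁻ (parityClass b) (∁ S) (∈-members⁻ x∈)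
... | x∈class , x∈∁S = x∈∁p⇒x∉p x∈∁S , parityClass-parity x∈class

pool-size : ∀ n (S : Subset n) b → n ≤ suc (2 * (length (pool S b) + ∣ S ∣))
pool-size n S b = begin
  n                                    ≤⟨ parityClass-size n b ⟩
  suc (2 * ∣ C ∣)                      ≤⟨ s≤s (*-monoʳ-≤ 2 (∣p∣≤∣p∩∁q∣+∣q∣ C S)) ⟩
  suc (2 * (∣ C ∩ ∁ S ∣ + ∣ S ∣))      ≡⟨ cong (λ m → suc (2 * (m + ∣ S ∣))) (length-members (C ∩ ∁ S)) ⟨
  suc (2 * (length (pool S b) + ∣ S ∣)) ∎
  where
  open ≤-Reasoning
  C : Subset n
  C = parityClass b

-- The parities even, even, odd, odd, … along each path: two steps apart they differ, which makes
-- consecutive edges of the path differently colored.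
ttff : ℕ → Bool
ttff 0 = true
ttff 1 = true
ttff 2 = false
ttff 3 = false
ttff (suc (suc (suc (suc p)))) = ttff p

ttff-flip : ∀ p → ttff p ≢ ttff (suc (suc p))
ttff-flip 0 ()
ttff-flip 1 ()
ttff-flip 2 ()
ttff-flip 3 ()
ttff-flip (suc (suc (suc (suc p)))) = ttff-flip p

ttff-periodic : ∀ j r → ttff (j * 4 + r) ≡ ttff r
ttff-periodic zero    r = refl
ttff-periodic (suc j) r = ttff-periodic j r

quotient-unique : ∀ {L q q′} i i′ → q < L → q′ < L → q + i * L ≡ q′ + i′ * L → q ≡ q′ × i ≡ i′
quotient-unique {L} {q} {q′} i i′ q<L q′<L eq = q≡q′ , i≡i′
  where
  instance _ = >-nonZero (≤-<-trans z≤n q<L)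
  q≡q′ : q ≡ q′
  q≡q′ = begin
    q               ≡⟨ m<n⇒m%n≡m q<L ⟨
    q % L           ≡⟨ [m+kn]%n≡m%n q i L ⟨
    (q + i * L) % L   ≡⟨ cong (_% L) eq ⟩
    (q′ + i′ * L) % L ≡⟨ [m+kn]%n≡m%n q′ i′ L ⟩
    q′ % L          ≡⟨ m<n⇒m%n≡m q′<L ⟩
    q′              ∎
    where open ≡-Reasoning
  i≡i′ : i ≡ i′
  i≡i′ = *-cancelʳ-≡ i i′ L (+-cancelˡ-≡ q _ _ (trans eq (cong (_+ i′ * L) (sym q≡q′))))

-- Path i visits s₀, …, s_{k-1} in blocks of four positions, s_j at position 4j or 4j + 2 as its
-- parity dictates; each other position of each path gets its own vertex outside S, of the parity
-- that ttff prescribes.  The vertex d is only the default of nth and is never reached.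
module ParityPaths {n : ℕ} (S : Subset n) (ℓ : ℕ) (d : Fin n)
  (room : ∀ b → ℓ * (∣ S ∣ * 4) ≤ length (pool S b)) where

  k L : ℕ
  k = ∣ S ∣
  L = k * 4

  s : ℕ → Fin n
  s = nth d (members S)

  data Label : Set where
    member fresh : ℕ → Label

  half : ℕ → ℕ
  half j = if parity (s j) then 0 else 1

  position : Label → ℕ
  position (member j) = j * 4 + 2 * half j
  position (fresh p)  = p

  label : ℕ → ℕ → Label
  label j 0 = if parity (s j) then member j else fresh (j * 4 + 0)
  label j 1 = fresh (j * 4 + 1)
  label j 2 = if parity (s j) then fresh (j * 4 + 2) else member j
  label j 3 = fresh (j * 4 + 3)
  label j (suc (suc (suc (suc p)))) = label (suc j) p

  position-label : ∀ j p → position (label j p) ≡ j * 4 + p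
  position-label j 0 with parity (s j) in eq
  ... | true  rewrite eq = refl
  ... | false = refl
  position-label j 1 = refl
  position-label j 2 with parity (s j) in eq
  ... | true  = refl
  ... | false rewrite eq = refl
  position-label j 3 = refl
  position-label j (suc (suc (suc (suc p)))) = begin
    position (label (suc j) p)  ≡⟨ position-label (suc j) p ⟩
    4 + j * 4 + p               ≡⟨ cong (_+ p) (+-comm 4 (j * 4)) ⟩
    j * 4 + 4 + p               ≡⟨ +-assoc (j * 4) 4 p ⟩
    j * 4 + (4 + p)             ∎
    where open ≡-Reasoning

  label-shift : ∀ i j r → label i (j * 4 + r) ≡ label (i + j) r
  label-shift i zero    r = cong (λ m → label m r) (sym (+-identityʳ i))
  label-shift i (suc j) r = trans (label-shift (suc i) j r) (cong (λ m → label m r) (sym (+-suc i j)))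

  label-member : ∀ j → label 0 (position (member j)) ≡ member j
  label-member j = trans (label-shift 0 j (2 * half j)) (in-half j)
    where
    in-half : ∀ j → label j (2 * half j) ≡ member j
    in-half j with parity (s j) in eq
    ... | true  rewrite eq = refl
    ... | false rewrite eq = refl

  2*half<4 : ∀ j → 2 * half j < 4
  2*half<4 j with parity (s j)
  ... | true  = s≤s z≤n
  ... | false = s≤s (s≤s (s≤s z≤n))

  member-position-even : ∀ j → ∃ λ h → position (member j) ≡ 2 * h
  member-position-even j = j * 2 + half j , lemma j (half j)
    where lemma : ∀ j h → j * 4 + 2 * h ≡ 2 * (j * 2 + h)
          lemma = solve-∀

  member-position< : ∀ {j} → j < k → position (member j) < L
  member-position< {j} j<k = begin-strict
    j * 4 + 2 * half j  <⟨ +-monoʳ-< (j * 4) (2*half<4 j) ⟩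
    j * 4 + 4           ≡⟨ +-comm (j * 4) 4 ⟩
    suc j * 4           ≤⟨ *-monoˡ-≤ 4 j<k ⟩
    L                   ∎
    where open ≤-Reasoning

  member-position<⁻ : ∀ {j} → position (member j) < L → j < k
  member-position<⁻ {j} lt = *-cancelʳ-< 4 j k (≤-<-trans (m≤m+n (j * 4) (2 * half j)) lt)

  member-parity : ∀ j → parity (s j) ≡ ttff (position (member j))
  member-parity j with parity (s j)
  ... | true  = sym (ttff-periodic j 0)
  ... | false = sym (ttff-periodic j 2)

  s-∈ : ∀ {j} → j < k → s j ∈ S
  s-∈ j<k = ∈-members⁻ (nth-∈ (members S) (subst (_ <_) (sym (length-members S)) j<k))

  s-injective : ∀ {j j′} → j < k → j′ < k → s j ≡ s j′ → j ≡ j′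
  s-injective j<k j′<k = nth-injective (members-unique S)
    (subst (_ <_) (sym (length-members S)) j<k) (subst (_ <_) (sym (length-members S)) j′<k)

  s-surjective : ∀ {v} → v ∈ S → ∃ λ j → j < k × s j ≡ v
  s-surjective v∈ with ∈⇒nth (∈-members⁺ v∈)
  ... | j , j< , eq = j , subst (j <_) (length-members S) j< , eq

  freshVertex : ℕ → ℕ → Fin n
  freshVertex i q = nth d (pool S (ttff q)) (q + i * L)

  fresh-index< : ∀ {i q} → i < ℓ → q < L → q + i * L < ℓ * L
  fresh-index< {i} i<ℓ q<L = ≤-trans (+-monoˡ-< (i * L) q<L) (*-monoˡ-≤ L i<ℓ)

  fresh-∈-pool : ∀ {i q} → i < ℓ → q < L → freshVertex i q ∈ˡ pool S (ttff q)
  fresh-∈-pool {q = q} i<ℓ q<L = nth-∈ (pool S (ttff q)) (≤-trans (fresh-index< i<ℓ q<L) (room (ttff q)))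

  fresh-∉ : ∀ {i q} → i < ℓ → q < L → freshVertex i q ∉ S
  fresh-∉ i<ℓ q<L = proj₁ (∈-pool (fresh-∈-pool i<ℓ q<L))

  fresh-parity : ∀ {i q} → i < ℓ → q < L → parity (freshVertex i q) ≡ ttff q
  fresh-parity i<ℓ q<L = proj₂ (∈-pool (fresh-∈-pool i<ℓ q<L))

  pool-nth-injective : ∀ {b b′ m m′} → m < length (pool S b) → m′ < length (pool S b′) →
    nth d (pool S b) m ≡ nth d (pool S b′) m′ → m ≡ m′
  pool-nth-injective {b} {b′} m< m′< eq
    with trans (sym (proj₂ (∈-pool (nth-∈ (pool S b) m<))))
               (trans (cong parity eq) (proj₂ (∈-pool (nth-∈ (pool S b′) m′<))))
  ... | refl = nth-injective (members-unique (parityClass b ∩ ∁ S)) m< m′< eq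

  fresh-injective : ∀ {i i′ q q′} → i < ℓ → i′ < ℓ → q < L → q′ < L →
    freshVertex i q ≡ freshVertex i′ q′ → i ≡ i′ × q ≡ q′
  fresh-injective {i} {i′} {q} {q′} i<ℓ i′<ℓ q<L q′<L eq = proj₂ same , proj₁ same
    where
    same : q ≡ q′ × i ≡ i′
    same = quotient-unique i i′ q<L q′<L (pool-nth-injective
      (≤-trans (fresh-index< i<ℓ q<L) (room (ttff q))) (≤-trans (fresh-index< i′<ℓ q′<L) (room (ttff q′))) eq)

  vertex : ℕ → Label → Fin n
  vertex i (member j) = s j
  vertex i (fresh q)  = freshVertex i q

  at : ℕ → ℕ → Fin n
  at i p = vertex i (label 0 p)

  data Occupant (i p : ℕ) : Set where
    is-member : ∀ j → j < k → position (member j) ≡ p → at i p ≡ s j → Occupant i p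
    is-fresh  : at i p ≡ freshVertex i p → Occupant i p

  occupant : ∀ i {p} → p < L → Occupant i p
  occupant i {p} p<L with label 0 p in eq
  ... | member j = is-member j (member-position<⁻ (subst (_< L) (sym position≡p) p<L)) position≡p
                     (cong (vertex i) eq)
    where
    position≡p : position (member j) ≡ p
    position≡p = trans (cong position (sym eq)) (position-label 0 p)
  ... | fresh q = is-fresh (trans (cong (vertex i) eq)
                    (cong (freshVertex i) (trans (cong position (sym eq)) (position-label 0 p))))

  at-parity : ∀ {i p} → i < ℓ → p < L → parity (at i p) ≡ ttff p
  at-parity {i} i<ℓ p<L with occupant i p<L
  ... | is-member j _ refl eq = trans (cong parity eq) (member-parity j)
  ... | is-fresh eq          = trans (cong parity eq) (fresh-parity i<ℓ p<L)

  at-injective : ∀ {i} → i < ℓ → ∀ {p q} → p < L → q < L → at i p ≡ at i q → p ≡ q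
  at-injective {i} i<ℓ p<L q<L eq with occupant i p<L | occupant i q<L
  ... | is-member j j<k refl e₁ | is-member j′ j′<k refl e₂
    = cong (position ∘ member) (s-injective j<k j′<k (trans (sym e₁) (trans eq e₂)))
  ... | is-member j j<k _ e₁ | is-fresh e₂ = ⊥-elim (fresh-∉ i<ℓ q<L (subst (_∈ S) (trans (sym e₁) (trans eq e₂)) (s-∈ j<k)))
  ... | is-fresh e₁ | is-member j j<k _ e₂ = ⊥-elim (fresh-∉ i<ℓ p<L (subst (_∈ S) (trans (sym e₂) (trans (sym eq) e₁)) (s-∈ j<k)))
  ... | is-fresh e₁ | is-fresh e₂ = proj₂ (fresh-injective i<ℓ i<ℓ p<L q<L (trans (sym e₁) (trans eq e₂)))

  at-shared-∈S : ∀ {i i′ p p′} → i < ℓ → i′ < ℓ → i ≢ i′ → p < L → p′ < L →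
    at i p ≡ at i′ p′ → at i p ∈ S
  at-shared-∈S {i} {i′} i<ℓ i′<ℓ i≢i′ p<L p′<L eq with occupant i p<L | occupant i′ p′<L
  ... | is-member j j<k _ e | _                 = subst (_∈ S) (sym e) (s-∈ j<k)
  ... | is-fresh _  | is-member j j<k _ e       = subst (_∈ S) (sym (trans eq e)) (s-∈ j<k)
  ... | is-fresh e₁ | is-fresh e₂ =
    ⊥-elim (i≢i′ (proj₁ (fresh-injective i<ℓ i′<ℓ p<L p′<L (trans (sym e₁) (trans eq e₂)))))

  at-∈S⇒even : ∀ {i p} → i < ℓ → p < L → at i p ∈ S → ∃ λ h → p ≡ 2 * h
  at-∈S⇒even {i} i<ℓ p<L at∈S with occupant i p<L
  ... | is-member j _ refl _ = member-position-even j
  ... | is-fresh e = ⊥-elim (fresh-∉ i<ℓ p<L (subst (_∈ S) e at∈S))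

  S-on-path : ∀ i {v} → v ∈ S → ∃ λ p → p < L × at i p ≡ v
  S-on-path i v∈ with s-surjective v∈
  ... | j , j<k , refl = position (member j) , member-position< j<k , cong (vertex i) (label-member j)

  ¬consecutive-∈S : ∀ {i p} → i < ℓ → suc p < L → at i p ∈ S → at i (suc p) ∈ S → ⊥
  ¬consecutive-∈S i<ℓ sp<L p∈ sp∈ with at-∈S⇒even i<ℓ (<-trans (n<1+n _) sp<L) p∈ | at-∈S⇒even i<ℓ sp<L sp∈
  ... | h , refl | h′ , e = even≢odd h′ h (sym e)

  module Tree {i} (i<ℓ : i < ℓ) = PathGraph (at i) L (at-injective i<ℓ)

  tree : ∀ {i} → i < ℓ → Subgraph (K n)
  tree i<ℓ = Tree.path i<ℓ

  tree-contains-S : ∀ {i} (i<ℓ : i < ℓ) → ContainsSet S (tree i<ℓ)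
  tree-contains-S {i} i<ℓ v v∈ = Tree.∈-vertices⁺ i<ℓ (S-on-path i v∈)

  tree-isProper : ∀ {i} (i<ℓ : i < ℓ) → IsProper (parityColoring n) (tree i<ℓ)
  tree-isProper {i} i<ℓ = Tree.path-isProper i<ℓ (parityColoring n) λ p ssp<L →
    parityColoring-alternates (at i p) (at i (suc p)) (at i (suc (suc p))) λ eq →
      ttff-flip p (trans (sym (at-parity i<ℓ (<-trans (≤-trans (n≤1+n _) (n<1+n _)) ssp<L)))
                  (trans eq (at-parity i<ℓ ssp<L)))

  trees-meet-in-S : ∀ {i i′} (i<ℓ : i < ℓ) (i′<ℓ : i′ < ℓ) → i ≢ i′ → ∀ v →
    v ∈ Subgraph.V (tree i<ℓ) → v ∈ Subgraph.V (tree i′<ℓ) → v ∈ S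
  trees-meet-in-S i<ℓ i′<ℓ i≢i′ v v∈ v∈′ with Tree.∈-vertices⁻ i<ℓ v∈ | Tree.∈-vertices⁻ i′<ℓ v∈′
  ... | p , p<L , refl | p′ , p′<L , eq = at-shared-∈S i<ℓ i′<ℓ i≢i′ p<L p′<L (sym eq)

  trees-edge-disjoint : ∀ {i i′} (i<ℓ : i < ℓ) (i′<ℓ : i′ < ℓ) → i ≢ i′ → ∀ u v →
    ¬ (Subgraph.E (tree i<ℓ) u v ≡ true × Subgraph.E (tree i′<ℓ) u v ≡ true)
  trees-edge-disjoint i<ℓ i′<ℓ i≢i′ u v (e , e′)
    with Tree.edges-ok i<ℓ u v e | Tree.edges-ok i′<ℓ u v e′ | Tree.edges⁻ i<ℓ e
  ... | _ , u∈ , v∈ | _ , u∈′ , v∈′ | p , _ , sp<L , inj₁ (refl , refl) =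
    ¬consecutive-∈S i<ℓ sp<L (trees-meet-in-S i<ℓ i′<ℓ i≢i′ u u∈ u∈′) (trees-meet-in-S i<ℓ i′<ℓ i≢i′ v v∈ v∈′)
  ... | _ , u∈ , v∈ | _ , u∈′ , v∈′ | p , _ , sp<L , inj₂ (refl , refl) =
    ¬consecutive-∈S i<ℓ sp<L (trees-meet-in-S i<ℓ i′<ℓ i≢i′ v v∈ v∈′) (trees-meet-in-S i<ℓ i′<ℓ i≢i′ u u∈ u∈′)

parityColoring-good : ∀ n k ℓ → 2 * (ℓ * (k * 4) + k) < n → GoodColoring (K n) k ℓ (parityColoring n)
parityColoring-good (suc m) .(∣ S ∣) ℓ big S refl = trees , properties , disjoint
  where
  room : ∀ b → ℓ * (∣ S ∣ * 4) ≤ length (pool S b)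
  room b = +-cancelʳ-≤ ∣ S ∣ _ _ (*-cancelˡ-≤ 2 (≤-pred (≤-trans big (pool-size (suc m) S b))))

  open ParityPaths S ℓ zero room

  trees : Fin ℓ → Subgraph (K (suc m))
  trees i = tree (toℕ<n i)

  properties : ∀ i → IsTree (trees i) × ContainsSet S (trees i) × IsProper (parityColoring (suc m)) (trees i)
  properties i = Tree.path-isTree (toℕ<n i) , tree-contains-S (toℕ<n i) , tree-isProper (toℕ<n i)

  disjoint : ∀ i j → i ≢ j → InternallyDisjoint S (trees i) (trees j)
  disjoint i j i≢j = trees-edge-disjoint (toℕ<n i) (toℕ<n j) toℕi≢toℕj
                   , trees-meet-in-S (toℕ<n i) (toℕ<n j) toℕi≢toℕj
    where
    toℕi≢toℕj : toℕ i ≢ toℕ j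
    toℕi≢toℕj eq = i≢j (toℕ-injective eq)

module OneColor {N : ℕ} (T : Subgraph (K N)) (c : Coloring N 1) (proper : IsProper c T) where
  open Subgraph T

  only-color : ∀ (a b : Fin 1) → a ≡ b
  only-color zero zero = refl

  -- Any edge leaving {a, b} would share an end, hence its color, with the edge ab.
  trapped : ∀ {a b x w} → E a b ≡ true → x ≡ a ⊎ x ≡ b → Walk E x w → w ≡ a ⊎ w ≡ b
  trapped eab x∈ab here = x∈ab
  trapped {a} {b} eab (inj₁ refl) (step {v = y} exy rest) with y ≟ᶠ b
  ... | yes refl = trapped eab (inj₂ refl) rest
  ... | no y≢b = ⊥-elim (proper b a y (y≢b ∘ sym) (trans (E-sym b a) eab) exy (only-color _ _))
  trapped {a} {b} eab (inj₂ refl) (step {v = y} exy rest) with y ≟ᶠ a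
  ... | yes refl = trapped eab (inj₁ refl) rest
  ... | no y≢a = ⊥-elim (proper a b y (y≢a ∘ sym) eab exy (only-color _ _))

  ¬three-vertices : IsTree T → ∀ {x y z} → x ≢ y → x ≢ z → y ≢ z → x ∈ V → y ∈ V → z ∈ V → ⊥
  ¬three-vertices (connected , _) x≢y x≢z y≢z x∈ y∈ z∈
    with connected _ _ x∈ y∈ | connected _ _ x∈ z∈
  ... | here | _ = x≢y refl
  ... | step exy rest | walk-xz with trapped exy (inj₂ refl) rest | trapped exy (inj₁ refl) walk-xz
  ... | inj₁ y≡x | _          = x≢y (sym y≡x)
  ... | inj₂ _   | inj₁ z≡x   = x≢z (sym z≡x)
  ... | inj₂ y≡w | inj₂ z≡w   = y≢z (trans y≡w (sym z≡w))

initialSegment : ∀ {k n} → k ≤ n → Subset n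
initialSegment {zero}  _         = ∅
initialSegment (s≤s k≤n) = true ∷ initialSegment k≤n

∣initialSegment∣ : ∀ {k n} (k≤n : k ≤ n) → ∣ initialSegment k≤n ∣ ≡ k
∣initialSegment∣ {zero} {n} _ = ∣⊥∣≡0 n
∣initialSegment∣ (s≤s k≤n)    = cong suc (∣initialSegment∣ k≤n)

¬good-with-one-color : ∀ {n k ℓ} → 3 ≤ k → k ≤ n → 1 ≤ ℓ → ¬ Σ (Coloring n 1) (GoodColoring (K n) k ℓ)
¬good-with-one-color (s≤s (s≤s (s≤s _))) k≤n@(s≤s (s≤s (s≤s _))) (s≤s _) (c , good)
  with good (initialSegment k≤n) (∣initialSegment∣ k≤n)
... | T , trees , _ with trees zero
... | isTree , contains , proper =
  OneColor.¬three-vertices (T zero) c proper isTree (λ ()) (λ ()) (λ ())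
    (contains zero here) (contains (suc zero) (there here)) (contains (suc (suc zero)) (there (there here)))

¬good-below-two-colors : ∀ n k ℓ → 3 ≤ k → k ≤ n → 1 ≤ ℓ → ∀ q → q < 2 → ¬ Σ (Coloring n q) (GoodColoring (K n) k ℓ)
¬good-below-two-colors n k ℓ (s≤s _) (s≤s _) _ zero          _ (c , _) = ¬Fin0 (Coloring.col c zero zero)
¬good-below-two-colors n k ℓ 3≤k     k≤n     1≤ℓ (suc zero)  _         = ¬good-with-one-color 3≤k k≤n 1≤ℓ
¬good-below-two-colors n k ℓ _       _       _ (suc (suc q)) (s≤s (s≤s ()))

-- With M = (ℓ + 1)(k − 1) one has ℓ(k − 1) + k = M + 1 and (M + 1)⁴ − 1 = M(M³ + 4M² + 6M + 4),
-- so the hypothesis amounts to 2(M³ + 4M² + 6M + 4) ≤ n + 1, far more than the paths need.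
hypothesis⇒enough-vertices : ∀ k ℓ n → 3 ≤ k → 1 ≤ ℓ →
  2 * ((ℓ * (k ∸ 1) + k) ^ 4 ∸ 1) ≤ (n + 1) * ((ℓ + 1) * (k ∸ 1)) →
  2 * (ℓ * (k * 4) + k) < n
hypothesis⇒enough-vertices (suc (suc (suc a))) (suc b) n (s≤s (s≤s (s≤s _))) (s≤s _) hyp = ≤-pred (begin
  suc (suc (2 * Y))                ≡⟨ +-comm 2 (2 * Y) ⟩
  2 * Y + 2                        ≤⟨ m≤m+n _ (4 * (a * b) + 14 * a + 24) ⟩
  2 * Y + 2 + (4 * (a * b) + 14 * a + 24) ≡⟨ paths-vs-M a b ⟩
  12 * M + 8                       ≤⟨ m≤m+n _ (2 * (M * M * M) + 8 * (M * M)) ⟩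
  12 * M + 8 + (2 * (M * M * M) + 8 * (M * M)) ≡⟨ expand M ⟩
  2 * P                            ≤⟨ *-cancelʳ-≤ (2 * P) (n + 1) M hyp′ ⟩
  n + 1                            ≡⟨ +-comm n 1 ⟩
  suc n                            ∎)
  where
  open ≤-Reasoning
  Y M P : ℕ
  Y = suc b * (suc (suc (suc a)) * 4) + suc (suc (suc a))
  M = (suc b + 1) * suc (suc a)
  P = M * M * M + 4 * (M * M) + 6 * M + 4

  paths-vs-M : ∀ a b → 2 * (suc b * (suc (suc (suc a)) * 4) + suc (suc (suc a))) + 2 + (4 * (a * b) + 14 * a + 24)
                     ≡ 12 * ((suc b + 1) * suc (suc a)) + 8
  paths-vs-M = solve-∀
  expand : ∀ m → 12 * m + 8 + (2 * (m * m * m) + 8 * (m * m)) ≡ 2 * (m * m * m + 4 * (m * m) + 6 * m + 4)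
  expand = solve-∀
  base≡1+M : ∀ a b → suc b * suc (suc a) + suc (suc (suc a)) ≡ suc ((suc b + 1) * suc (suc a))
  base≡1+M = solve-∀
  1+M^4 : ∀ m → (1 + m) * ((1 + m) * ((1 + m) * ((1 + m) * 1))) ≡ 1 + (m * m * m + 4 * (m * m) + 6 * m + 4) * m
  1+M^4 = solve-∀
  hyp′ : 2 * P * M ≤ (n + 1) * M
  hyp′ = subst (_≤ (n + 1) * M) (begin-equality
    2 * ((suc b * suc (suc a) + suc (suc (suc a))) ^ 4 ∸ 1) ≡⟨ cong (λ x → 2 * (x ^ 4 ∸ 1)) (base≡1+M a b) ⟩
    2 * (suc M ^ 4 ∸ 1)                                   ≡⟨ cong (λ x → 2 * (x ∸ 1)) (1+M^4 M) ⟩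
    2 * (P * M)                                           ≡⟨ *-assoc 2 P M ⟨
    2 * P * M                                             ∎) hyp

theorem2p9 : (k ℓ n : ℕ) → 3 ≤ k → 1 ≤ ℓ →
  2 * ((ℓ * (k ∸ 1) + k) ^ 4 ∸ 1) ≤ (n + 1) * ((ℓ + 1) * (k ∸ 1)) →
  PxIs (K n) k ℓ 2
theorem2p9 k ℓ n 3≤k 1≤ℓ hyp =
  (parityColoring n , parityColoring-good n k ℓ enough) , ¬good-below-two-colors n k ℓ 3≤k k≤n 1≤ℓ
  where
  enough : 2 * (ℓ * (k * 4) + k) < n
  enough = hypothesis⇒enough-vertices k ℓ n 3≤k 1≤ℓ hyp
  k≤n : k ≤ n
  k≤n = ≤-trans (≤-trans (m≤n+m k (ℓ * (k * 4))) (m≤m+n _ _)) (<⇒≤ enough)
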